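{- Let $1\le n\le\omega$. Then (1) $\mathbf{QH}\subsetneq\mathbf{QHt}\subsetneq\mathbf{QHt}_n$ and $\mathbf{QHt}\subsetneq\mathbf{QHt}^{\mathrm{fin}}$; and (2) $\mathbf{QHt}^{\mathrm{fin}}\not\subseteq\mathbf{QHt}_n$ and $\mathbf{QHt}_n\not\subseteq\mathbf{QHt}^{\mathrm{fin}}$.
   Context: Formulas of quantified propositional intuitionistic logic are built from propositional variables and $\bot$ using $\land,\lor,\to$ and quantifiers $\forall p,\exists p$ over propositional variables; $\neg A$ abbreviates $A\to\bot$. A model structure $\langle g,K,\le\rangle$ is a set $K$ with a partial order $\le$ having least element $g$. A proposition is an upward-closed subset of $K$. A model $M=\langle g,K,\le,\phi\rangle$ adds a valuation $\phi$ mapping propositional variables to propositions; $M[P/p]$ is $M$ with $p$ reassigned to $P$. Truth at $h\in K$: $M,h\models p$ iff $h\in\phi(p)$; never $M,h\models\bot$; $\land,\lor$ pointwise; $M,h\models B\to C$ iff for all $h'\ge h$, $M,h'\not\models B$ or $M,h'\models C$; $M,h\models\forall p\,B$ iff $M[P/p],h\models B$ for all propositions $P$; $M,h\models\exists p\,B$ iff this holds for some proposition $P$. $M$ validates $A$ if $M,g\models A$; $A$ is valid in a class of structures if every model based on a structure in the class validates $A$. $\mathbf{QH}$ is the set of formulas valid in all model structures. A tree is a subset $T\subseteq\omega^*$ closed under initial segments, ordered by the prefix order, with root the empty word $\Lambda$; for $n\le\omega$, $T_n=\{i:0\le i<n\}^*$. $\mathbf{QHt}$ is the set of formulas valid in all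 structures $\langle\Lambda,T,\le\rangle$ with $T$ a tree; $\mathbf{QHt}_n$ those valid in $\langle\Lambda,T_n,\le\rangle$; $\mathbf{QHt}^{\mathrm{fin}}$ those valid in all $\langle\Lambda,T,\le\rangle$ with $T$ a finite tree. -}

module Defs where

open import Level using (Level; 0ℓ) renaming (suc to lsuc)
open import Data.Nat using (ℕ; _<_; _≟_) renaming (_≤_ to _≤ℕ_)
open import Data.List using (List; []; _∷_)
open import Data.List.Membership.Propositional using (_∈_)
open import Data.List.Relation.Unary.All using (All)
open import Data.List.Relation.Binary.Prefix.Heterogeneous using (Prefix; [])
import Data.List.Relation.Binary.Prefix.Homogeneous.Properties as PrefixProps
import Data.List.Relation.Binary.Pointwise as PW
open import Data.Product using (Σ; Σ-syntax; ∃; ∃-syntax; _×_; _,_; proj₁; proj₂)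
open import Data.Sum using (_⊎_)
open import Data.Unit using (⊤)
open import Data.Empty using (⊥)
open import Relation.Nullary using (¬_; yes; no)
open import Relation.Binary using (IsPartialOrder; Rel)
open import Relation.Binary.PropositionalEquality using (_≡_; refl)
import Relation.Binary.Construct.On as On
open import Relation.Binary.PropositionalEquality.Properties using (isPartialOrder)

data Formula : Set where
  var  : ℕ → Formula
  ⊥'   : Formula
  _∧'_ : Formula → Formula → Formula
  _∨'_ : Formula → Formula → Formula
  _⇒'_ : Formula → Formula → Formula
  ∀'   : ℕ → Formula → Formula
  ∃'   : ℕ → Formula → Formula

¬' : Formula → Formula
¬' A = A ⇒' ⊥'

record Structure : Set₁ where
  field
    K         : Set
    _≈_       : Rel K 0ℓ
    _≤_       : Rel K 0ℓ
    isPO      : IsPartialOrder _≈_ _≤_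
    g         : K
    least     : ∀ h → g ≤ h

UpClosed : (S : Structure) → (Structure.K S → Set) → Set
UpClosed S P = ∀ {h h'} → Structure._≤_ S h h' → P h → P h'

Proposition : Structure → Set₁
Proposition S = Σ (Structure.K S → Set) (UpClosed S)

Valuation : Structure → Set₁
Valuation S = ℕ → Proposition S

_[_↦_] : {S : Structure} → Valuation S → ℕ → Proposition S → Valuation S
(φ [ p ↦ P ]) q with q ≟ p
... | yes _ = P
... | no  _ = φ q

Sat : (S : Structure) → Valuation S → Structure.K S → Formula → Set₁
Sat S φ h (var p)   = Level.Lift (lsuc 0ℓ) (proj₁ (φ p) h)
Sat S φ h ⊥'        = Level.Lift (lsuc 0ℓ) ⊥
Sat S φ h (A ∧' B)  = Sat S φ h A × Sat S φ h B
Sat S φ h (A ∨' B)  = Sat S φ h A ⊎ Sat S φ h B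
Sat S φ h (A ⇒' B)  = ∀ h' → Structure._≤_ S h h' → ¬ Sat S φ h' A ⊎ Sat S φ h' B
Sat S φ h (∀' p A)  = (P : Proposition S) → Sat S (_[_↦_] {S} φ p P) h A
Sat S φ h (∃' p A)  = Σ[ P ∈ Proposition S ] Sat S (_[_↦_] {S} φ p P) h A

ValidIn : Structure → Formula → Set₁
ValidIn S A = (φ : Valuation S) → Sat S φ (Structure.g S) A

_≼_ : List ℕ → List ℕ → Set
_≼_ = Prefix _≡_

record Tree : Set₁ where
  field
    mem      : List ℕ → Set
    root     : mem []
    initSeg  : ∀ {u w} → u ≼ w → mem w → mem u

open Tree public

treeStructure : Tree → Structure
treeStructure T = record
  { K     = Σ (List ℕ) (mem T)
  ; _≈_   = λ x y → PW.Pointwise _≡_ (proj₁ x) (proj₁ y)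
  ; _≤_   = λ x y → proj₁ x ≼ proj₁ y
  ; isPO  = On.isPartialOrder proj₁ (PrefixProps.isPartialOrder isPartialOrder)
  ; g     = [] , root T
  ; least = λ h → []
  }

FiniteTree : Tree → Set
FiniteTree T = Σ[ l ∈ List (List ℕ) ] (∀ w → mem T w → w ∈ l)

data Bound : Set where
  fin : ℕ → Bound
  ω   : Bound

Positive : Bound → Set
Positive (fin n) = 1 ≤ℕ n
Positive ω       = ⊤

Below : Bound → ℕ → Set
Below (fin n) i = i < n
Below ω       i = ⊤

Tn : Bound → Tree
Tn n = record
  { mem     = All (Below n)
  ; root    = All.[]
  ; initSeg = restrict
  }
  where
  restrict : ∀ {u w} → u ≼ w → All (Below n) w → All (Below n) u
  restrict [] _ = All.[]
  restrict (refl Prefix.∷ p) (x All.∷ xs) = x All.∷ restrict p xs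

QH : Formula → Set₁
QH A = (S : Structure) → ValidIn S A

QHt : Formula → Set₁
QHt A = (T : Tree) → ValidIn (treeStructure T) A

QHt[_] : Bound → Formula → Set₁
QHt[ n ] A = ValidIn (treeStructure (Tn n)) A

QHtfin : Formula → Set₁
QHtfin A = (T : Tree) → FiniteTree T → ValidIn (treeStructure T) A

_⊆L_ : ∀ {a b} → (Formula → Set a) → (Formula → Set b) → Set _
L₁ ⊆L L₂ = ∀ A → L₁ A → L₂ A

_⊊L_ : ∀ {a b} → (Formula → Set a) → (Formula → Set b) → Set _
L₁ ⊊L L₂ = (L₁ ⊆L L₂) × (Σ[ A ∈ Formula ] (L₂ A × ¬ L₁ A))

_⊈L_ : ∀ {a b} → (Formula → Set a) → (Formula → Set b) → Set _
L₁ ⊈L L₂ = Σ[ A ∈ Formula ] (L₁ A × ¬ L₂ A)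

{-# OPTIONS --safe #-}

-- Three formulas separate the logics. ¬ ∀p (p ∨ ¬p) holds at every point with a strict successor
-- w (refute p ∨ ¬p with p the cone above w), so it is valid in T_n. Classically p ∨ ¬p holds at
-- maximal points, so ¬¬ ∀p (p ∨ ¬p) is valid whenever every point lies below a maximal one, as in
-- finite trees. As ¬A and ¬¬A are never valid together, the first fails in the one-point tree and
-- the second in T_n. Finally ∀p ∀q ∀r (atomic(r) → (p → q ∨ ¬r) ∨ (q → p ∨ ¬r)), where atomic(r)
-- says that the points above forcing r are pairwise ≤, is valid whenever the points below any
-- point are linearly ordered, as in trees, but fails at the bottom of the four-element Boolean
-- lattice.

module Submission where

open import Defs
open import Data.Product using (_×_)
open import Axiom.ExcludedMiddle using (ExcludedMiddle)
open import Level using (0ℓ; suc)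

open import Level using (Lift; lift; lower)
open import Data.Bool using (Bool; true; false; f≤t; b≤b) renaming (_≤_ to _≤ᵇ_)
open import Data.Bool.Properties using (≤-isPartialOrder; ≤-minimum)
open import Data.Empty using (⊥; ⊥-elim)
open import Data.List using ([]; _∷_; _∷ʳ_; length)
open import Data.List.Extrema.Nat using (argmax; f[xs]≤f[argmax])
open import Data.List.Relation.Binary.Prefix.Heterogeneous using ([]; _∷_)
import Data.List.Relation.Unary.All as All
import Data.List.Relation.Unary.All.Properties as All
open import Data.List.Relation.Unary.Any using (here)
open import Data.Nat as ℕ using (ℕ; zero; _<_; _+_; s≤s; z≤n)
import Data.Nat.Properties as ℕₚ
open import Data.Nat.Properties using (<⇒≱; +-suc; +-monoʳ-≤; m≤m+n)
open import Data.Product using (Σ-syntax; _,_; proj₁; proj₂)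
open import Data.Product.Relation.Binary.Pointwise.NonDependent using (Pointwise; ×-isPartialOrder)
open import Data.Sum using (_⊎_; inj₁; inj₂; [_,_])
open import Data.Unit using (⊤; tt)
open import Function using (_∘_)
open import Relation.Binary using (IsPartialOrder)
open import Relation.Binary.PropositionalEquality using (_≡_; refl)
open import Relation.Nullary using (¬_; yes; no; contradiction)
open import Relation.Nullary.Decidable using (decidable-stable)

lem : Formula
lem = ∀' 0 (var 0 ∨' ¬' (var 0))

impliesUnless : ℕ → ℕ → ℕ → Formula
impliesUnless a b c = var a ⇒' (var b ∨' ¬' (var c))

atomic : Formula
atomic = ∀' 3 ((var 2 ⇒' var 3) ∨' (var 2 ⇒' ¬' (var 3)))

relativeDummett : Formula
relativeDummett = impliesUnless 0 1 2 ∨' impliesUnless 1 0 2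

treeFormula : Formula
treeFormula = ∀' 0 (∀' 1 (∀' 2 (atomic ⇒' relativeDummett)))

¬⊎⇒→ : ∀ {a b} {A : Set a} {B : Set b} → ¬ A ⊎ B → A → B
¬⊎⇒→ (inj₁ ¬a) a = contradiction a ¬a
¬⊎⇒→ (inj₂ b)  _ = b

module _ (S : Structure) where
  open Structure S
  open IsPartialOrder isPO using () renaming (refl to ≤-refl; trans to ≤-trans)

  cone : K → Proposition S
  cone w = (w ≤_) , λ h≤h' w≤h → ≤-trans w≤h h≤h'

  fullValuation : Valuation S
  fullValuation _ = (λ _ → ⊤) , λ _ _ → tt

  update₀₁₂ : Valuation S → (P Q R : Proposition S) → Valuation S
  update₀₁₂ φ P Q R = _[_↦_] {S} (_[_↦_] {S} (_[_↦_] {S} φ 0 P) 1 Q) 2 R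

  Maximal : K → Set
  Maximal m = ∀ w → m ≤ w → w ≤ m

  StrictSuccessors : Set
  StrictSuccessors = ∀ h → Σ[ w ∈ K ] (h ≤ w × ¬ w ≤ h)

  MaximalAbove : Set
  MaximalAbove = ∀ h → Σ[ m ∈ K ] (h ≤ m × Maximal m)

  DownSetsLinear : Set
  DownSetsLinear = ∀ {x y w} → x ≤ w → y ≤ w → x ≤ y ⊎ y ≤ x

  Falsifier : (P Q R : Proposition S) → K → Set
  Falsifier P Q R h = Σ[ x ∈ K ] (h ≤ x × proj₁ P x × ¬ proj₁ Q x × Σ[ w ∈ K ] (x ≤ w × proj₁ R w))

  AtomAbove : K → Proposition S → Set
  AtomAbove h R = ∀ {x y} → h ≤ x → h ≤ y → proj₁ R x → proj₁ R y → x ≤ y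

  lem-fails-below-strict-successor : ∀ φ {h w} → h ≤ w → ¬ w ≤ h → ¬ Sat S φ h lem
  lem-fails-below-strict-successor φ {w = w} h≤w w≰h lem-h with lem-h (cone w)
  ... | inj₁ (lift w≤h) = w≰h w≤h
  ... | inj₂ ¬w≤ = lower (¬⊎⇒→ (¬w≤ w h≤w) (lift ≤-refl))

  strictSuccessors⇒¬lem-valid : StrictSuccessors → ValidIn S (¬' lem)
  strictSuccessors⇒¬lem-valid successor φ h _ =
    let w , h≤w , w≰h = successor h in inj₁ (lem-fails-below-strict-successor φ h≤w w≰h)

  ¬-valid⇒¬¬-invalid : ∀ A → ValidIn S (¬' A) → ¬ ValidIn S (¬' (¬' A))
  ¬-valid⇒¬¬-invalid A ¬A-valid ¬¬A-valid =
    lower (¬⊎⇒→ (¬¬A-valid fullValuation g ≤-refl) (¬A-valid fullValuation))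

  falsifier⇒¬impliesUnless : ∀ φ a b c {h} → Falsifier (φ a) (φ b) (φ c) h →
                             ¬ Sat S φ h (impliesUnless a b c)
  falsifier⇒¬impliesUnless φ a b c (x , h≤x , Px , ¬Qx , w , x≤w , Rw) sat
    with ¬⊎⇒→ (sat x h≤x) (lift Px)
  ... | inj₁ (lift Qx) = ¬Qx Qx
  ... | inj₂ ¬R = lower (¬⊎⇒→ (¬R w x≤w) (lift Rw))

  atomic⇒atomAbove : ∀ φ {h} → Sat S φ h atomic → AtomAbove h (φ 2)
  atomic⇒atomAbove φ at {x} {y} h≤x h≤y Rx Ry with at (cone x)
  ... | inj₁ R⇒x≤ = lower (¬⊎⇒→ (R⇒x≤ y h≤y) (lift Ry))
  ... | inj₂ R⇒x≰ = ⊥-elim (lower (¬⊎⇒→ (¬⊎⇒→ (R⇒x≰ x h≤x) (lift Rx) x ≤-refl) (lift ≤-refl)))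

  -- The atom puts w below v, so x and y both lie below v and are comparable.
  falsifiers-clash : DownSetsLinear → ∀ P Q R {h} → AtomAbove h R →
                     Falsifier P Q R h → Falsifier Q P R h → ⊥
  falsifiers-clash linear P Q R atom
    (x , h≤x , Px , ¬Qx , w , x≤w , Rw) (y , h≤y , Qy , ¬Py , v , y≤v , Rv)
    with linear (≤-trans x≤w (atom (≤-trans h≤x x≤w) (≤-trans h≤y y≤v) Rw Rv)) y≤v
  ... | inj₁ x≤y = ¬Py (proj₂ P x≤y Px)
  ... | inj₂ y≤x = ¬Qx (proj₂ Q y≤x Qy)

≼-∷ʳ : ∀ u (x : ℕ) → u ≼ (u ∷ʳ x)
≼-∷ʳ []      x = []
≼-∷ʳ (y ∷ u) x = refl ∷ ≼-∷ʳ u x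

∷ʳ-⋠ : ∀ u (x : ℕ) → ¬ (u ∷ʳ x) ≼ u
∷ʳ-⋠ []      x ()
∷ʳ-⋠ (y ∷ u) x (refl ∷ p) = ∷ʳ-⋠ u x p

≼-linear-below : ∀ {u v w} → u ≼ w → v ≼ w → u ≼ v ⊎ v ≼ u
≼-linear-below []         _          = inj₁ []
≼-linear-below (_ ∷ _)    []         = inj₂ []
≼-linear-below (refl ∷ p) (refl ∷ q) with ≼-linear-below p q
... | inj₁ u≼v = inj₁ (refl ∷ u≼v)
... | inj₂ v≼u = inj₂ (refl ∷ v≼u)

≼-strict⇒length-< : ∀ {u w} → u ≼ w → ¬ w ≼ u → length u < length w
≼-strict⇒length-< {w = []}    []         w⋠u = contradiction [] w⋠u
≼-strict⇒length-< {w = _ ∷ _} []         _   = s≤s z≤n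
≼-strict⇒length-< (refl ∷ p) w⋠u = s≤s (≼-strict⇒length-< p (w⋠u ∘ (refl ∷_)))

Tn-strictSuccessors : ∀ n → Positive n → StrictSuccessors (treeStructure (Tn n))
Tn-strictSuccessors n n≥1 (u , u∈Tn) =
  (u ∷ʳ 0 , All.∷ʳ⁺ u∈Tn (zero-below n n≥1)) , ≼-∷ʳ u 0 , ∷ʳ-⋠ u 0
  where
  zero-below : ∀ n → Positive n → Below n 0
  zero-below (fin _) n≥1 = n≥1
  zero-below ω       _   = tt

finiteTree-height-bound : ∀ T → FiniteTree T → Σ[ b ∈ ℕ ] (∀ w → mem T w → length w ℕ.≤ b)
finiteTree-height-bound T (ws , enumerates) =
  length (argmax length [] ws) , λ w w∈T → All.lookup (f[xs]≤f[argmax] [] ws) (enumerates w w∈T)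

pointTree : Tree
pointTree = record { mem = _≡ [] ; root = refl ; initSeg = λ { [] refl → refl } }

pointTree-finite : FiniteTree pointTree
pointTree-finite = ([] ∷ []) , λ { _ refl → here refl }

diamond : Structure
diamond = record
  { K     = Bool × Bool
  ; _≈_   = Pointwise _≡_ _≡_
  ; _≤_   = Pointwise _≤ᵇ_ _≤ᵇ_
  ; isPO  = ×-isPartialOrder ≤-isPartialOrder ≤-isPartialOrder
  ; g     = false , false
  ; least = λ (a , b) → ≤-minimum a , ≤-minimum b
  }

module Classical (em : ExcludedMiddle 0ℓ) where

  →⇒¬⊎ : ∀ {b} {A : Set} {B : Set b} → (A → B) → ¬ Lift (suc 0ℓ) A ⊎ B
  →⇒¬⊎ {A = A} f with em {A}
  ... | yes a = inj₂ (f a)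
  ... | no ¬a = inj₁ (¬a ∘ lower)

  module _ (S : Structure) where
    open Structure S
    open IsPartialOrder isPO using () renaming (refl to ≤-refl; trans to ≤-trans)

    lem-holds-at-maximal : ∀ φ {m} → Maximal S m → Sat S φ m lem
    lem-holds-at-maximal φ {m} maximal P with em {proj₁ P m}
    ... | yes Pm = inj₁ (lift Pm)
    ... | no ¬Pm = inj₂ λ w m≤w → inj₁ λ (lift Pw) → ¬Pm (proj₂ P (maximal w m≤w) Pw)

    maximalAbove⇒¬¬lem-valid : MaximalAbove S → ValidIn S (¬' (¬' lem))
    maximalAbove⇒¬¬lem-valid above φ h _ = inj₁ λ ¬lem →
      let m , h≤m , maximal = above h in lower (¬⊎⇒→ (¬lem m h≤m) (lem-holds-at-maximal φ maximal))

    maximalAbove-of-bounded-rank : (rank : K → ℕ) (b : ℕ) → (∀ h → rank h ℕ.≤ b) →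
                                   (∀ {h w} → h ≤ w → ¬ w ≤ h → rank h < rank w) → MaximalAbove S
    maximalAbove-of-bounded-rank rank b bounded rank-increases h = climb b h (m≤m+n b (rank h))
      where
      -- k bounds the number of strict steps still possible above h.
      climb : ∀ k h → b ℕ.≤ k + rank h → Σ[ m ∈ K ] (h ≤ m × Maximal S m)
      climb k h _ with em {Σ[ w ∈ K ] (h ≤ w × ¬ w ≤ h)}
      ... | no ¬successor =
        h , ≤-refl , λ w h≤w → decidable-stable em λ w≰h → ¬successor (w , h≤w , w≰h)
      climb zero    h b≤rh | yes (w , h≤w , w≰h) =
        contradiction (ℕₚ.≤-trans (bounded w) b≤rh) (<⇒≱ (rank-increases h≤w w≰h))
      climb (ℕ.suc k) h b≤k+1+rh | yes (w , h≤w , w≰h) =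
        let m , w≤m , maximal = climb k w b≤k+rw in m , ≤-trans h≤w w≤m , maximal
        where
        b≤k+rw : b ℕ.≤ k + rank w
        b≤k+rw = begin
          b                  ≤⟨ b≤k+1+rh ⟩
          ℕ.suc (k + rank h) ≡⟨ +-suc k (rank h) ⟨
          k + ℕ.suc (rank h) ≤⟨ +-monoʳ-≤ k (rank-increases h≤w w≰h) ⟩
          k + rank w         ∎
          where open ℕₚ.≤-Reasoning

    ¬falsifier⇒impliesUnless : ∀ φ a b c {h} → ¬ Falsifier S (φ a) (φ b) (φ c) h →
                               Sat S φ h (impliesUnless a b c)
    ¬falsifier⇒impliesUnless φ a b c ¬falsifier x h≤x with em {proj₁ (φ b) x}
    ... | yes Qx = inj₂ (inj₁ (lift Qx))
    ... | no ¬Qx = →⇒¬⊎ λ Px → inj₂ λ w x≤w →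
      inj₁ λ (lift Rw) → ¬falsifier (x , h≤x , Px , ¬Qx , w , x≤w , Rw)

    atomAbove⇒atomic : ∀ φ {h} → AtomAbove S h (φ 2) → Sat S φ h atomic
    atomAbove⇒atomic φ {h} atom T with em {Σ[ x ∈ K ] (h ≤ x × proj₁ (φ 2) x × proj₁ T x)}
    ... | yes (x , h≤x , Rx , Tx) = inj₁ λ y h≤y → →⇒¬⊎ λ Ry → lift (proj₂ T (atom h≤x h≤y Rx Ry) Tx)
    ... | no ¬RT = inj₂ λ y h≤y → →⇒¬⊎ λ Ry z y≤z →
      inj₁ λ (lift Tz) → ¬RT (z , ≤-trans h≤y y≤z , proj₂ (φ 2) y≤z Ry , Tz)

    downSetsLinear⇒atomic⇒relativeDummett : DownSetsLinear S → ∀ ψ h →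
                                            Sat S ψ h (atomic ⇒' relativeDummett)
    downSetsLinear⇒atomic⇒relativeDummett linear ψ _ h _
      with em {Falsifier S (ψ 0) (ψ 1) (ψ 2) h} | em {Falsifier S (ψ 1) (ψ 0) (ψ 2) h}
    ... | no ¬f | _      = inj₂ (inj₁ (¬falsifier⇒impliesUnless ψ 0 1 2 ¬f))
    ... | yes _ | no ¬f  = inj₂ (inj₂ (¬falsifier⇒impliesUnless ψ 1 0 2 ¬f))
    ... | yes f | yes f' =
      inj₁ λ at → falsifiers-clash S linear (ψ 0) (ψ 1) (ψ 2) (atomic⇒atomAbove S ψ at) f f'

    downSetsLinear⇒treeFormula-valid : DownSetsLinear S → ValidIn S treeFormula
    downSetsLinear⇒treeFormula-valid linear φ P Q R =
      downSetsLinear⇒atomic⇒relativeDummett linear (update₀₁₂ S φ P Q R) g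

  finiteTree-maximalAbove : ∀ T → FiniteTree T → MaximalAbove (treeStructure T)
  finiteTree-maximalAbove T finite =
    let b , bounded = finiteTree-height-bound T finite in
    maximalAbove-of-bounded-rank (treeStructure T) (length ∘ proj₁) b
      (λ (w , w∈T) → bounded w w∈T) ≼-strict⇒length-<

  treeFormula-invalid-in-diamond : ¬ ValidIn diamond treeFormula
  treeFormula-invalid-in-diamond valid =
    [ (λ ¬atomic → ¬atomic (atomAbove⇒atomic diamond ψ top-is-atom))
    , [ falsifier⇒¬impliesUnless diamond ψ 0 1 2 left-falsifies
      , falsifier⇒¬impliesUnless diamond ψ 1 0 2 right-falsifies
      ]
    ] (valid (fullValuation diamond) p q r bottom (b≤b , b≤b))
    where
    bottom left right top : Bool × Bool
    bottom = false , false
    left   = true  , false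
    right  = false , true
    top    = true  , true

    p q r : Proposition diamond
    p = cone diamond left
    q = cone diamond right
    r = cone diamond top

    ψ : Valuation diamond
    ψ = update₀₁₂ diamond (fullValuation diamond) p q r

    top-is-atom : AtomAbove diamond bottom r
    top-is-atom _ _ (b≤b , b≤b) (b≤b , b≤b) = b≤b , b≤b

    left-falsifies : Falsifier diamond p q r bottom
    left-falsifies = left , (f≤t , b≤b) , (b≤b , b≤b) , (λ ()) , top , (b≤b , f≤t) , (b≤b , b≤b)

    right-falsifies : Falsifier diamond q p r bottom
    right-falsifies = right , (b≤b , f≤t) , (b≤b , b≤b) , (λ ()) , top , (f≤t , b≤b) , (b≤b , b≤b)

mainTheorem2 : ExcludedMiddle 0ℓ → ExcludedMiddle (suc 0ℓ) →
    (n : Bound) → Positive n →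
    ((QH ⊊L QHt) × (QHt ⊊L QHt[ n ]) × (QHt ⊊L QHtfin))
    × ((QHtfin ⊈L QHt[ n ]) × (QHt[ n ] ⊈L QHtfin))
mainTheorem2 em _ n n≥1 =
  ( ( (λ _ valid T → valid (treeStructure T))
    , treeFormula , treeFormula-valid-in-trees , λ valid → treeFormula-invalid-in-diamond (valid diamond) )
  , ( (λ _ valid → valid (Tn n))
    , ¬' lem , ¬lem-valid-in-Tn , λ valid → ¬lem-invalid-in-pointTree (valid pointTree) )
  , ( (λ _ valid T _ → valid T)
    , ¬' (¬' lem) , ¬¬lem-valid-in-finite-trees , λ valid → ¬¬lem-invalid-in-Tn (valid (Tn n)) ) )
  , ( (¬' (¬' lem) , ¬¬lem-valid-in-finite-trees , ¬¬lem-invalid-in-Tn)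
    , (¬' lem , ¬lem-valid-in-Tn , λ valid → ¬lem-invalid-in-pointTree (valid pointTree pointTree-finite)) )
  where
  open Classical em

  treeFormula-valid-in-trees : QHt treeFormula
  treeFormula-valid-in-trees T = downSetsLinear⇒treeFormula-valid (treeStructure T) ≼-linear-below

  ¬lem-valid-in-Tn : QHt[ n ] (¬' lem)
  ¬lem-valid-in-Tn = strictSuccessors⇒¬lem-valid (treeStructure (Tn n)) (Tn-strictSuccessors n n≥1)

  ¬¬lem-invalid-in-Tn : ¬ QHt[ n ] (¬' (¬' lem))
  ¬¬lem-invalid-in-Tn = ¬-valid⇒¬¬-invalid (treeStructure (Tn n)) lem ¬lem-valid-in-Tn

  ¬¬lem-valid-in-finite-trees : QHtfin (¬' (¬' lem))
  ¬¬lem-valid-in-finite-trees T finite =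
    maximalAbove⇒¬¬lem-valid (treeStructure T) (finiteTree-maximalAbove T finite)

  ¬lem-invalid-in-pointTree : ¬ ValidIn (treeStructure pointTree) (¬' lem)
  ¬lem-invalid-in-pointTree valid =
    ¬-valid⇒¬¬-invalid (treeStructure pointTree) lem valid (¬¬lem-valid-in-finite-trees pointTree pointTree-finite)
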